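{- Let $t=(a,b,c,d)$ be a triangle quadruple. Then applying to $t$ the generator corresponding to a largest entry of $t$ (i.e. replacing a largest entry, say $a$, by $b+c+d-a$, and analogously for the other positions) does not increase the sum $a+b+c+d$. Moreover, $t$ can be transformed, by applying finitely many of the generators $S_1,S_2,S_3,S_4$, into a root quadruple $t'$ equal to $(0,x,x,x)$ or a permutation of it, where $x=\gcd(a,b,c,d)$.
   Context: A triangle quadruple is a quadruple $(a,b,c,d)$ of nonnegative integers satisfying $3(a^2+b^2+c^2+d^2)=(a+b+c+d)^2$. The triangle group $T$ is the subgroup of $GL(4,\mathbb{Z})$ generated by $S_1,S_2,S_3,S_4$, acting on column vectors $(a,b,c,d)^T$, where $S_1(a,b,c,d)^T=(b+c+d-a,\,b,\,c,\,d)^T$, $S_2(a,b,c,d)^T=(a,\,a+c+d-b,\,c,\,d)^T$, $S_3(a,b,c,d)^T=(a,\,b,\,a+b+d-c,\,d)^T$, $S_4(a,b,c,d)^T=(a,\,b,\,c,\,a+b+c-d)^T$; $S_i$ is the generator corresponding to the $i$-th entry. These maps send triangle quadruples to triangle quadruples. A triangle quadruple is a root quadruple if no generator $S_i$ applied to it yields a quadruple with strictly smaller sum of entries. -}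

module Defs where

open import Data.Nat using (ℕ)
open import Data.Nat.GCD using (gcd)
open import Data.Integer using (ℤ; +_; _+_; _-_; _*_; _≤_; _<_; ∣_∣)
open import Data.Fin using (Fin; zero; suc)
open import Data.Fin.Permutation using (Permutation′; _⟨$⟩ʳ_)
open import Data.List using (List; []; _∷_)
open import Data.Product using (Σ; _×_; ∃)
open import Relation.Binary.PropositionalEquality using (_≡_)
open import Relation.Nullary using (¬_)

record Quad : Set where
  constructor quad
  field
    a b c d : ℤ
open Quad public

entry : Quad → Fin 4 → ℤ
entry t zero = a t
entry t (suc zero) = b t
entry t (suc (suc zero)) = c t
entry t (suc (suc (suc zero))) = d t

qsum : Quad → ℤ
qsum t = a t + b t + c t + d t

sq : ℤ → ℤ
sq x = x * x

IsTriangle : Quad → Set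
IsTriangle t = (∀ i → + 0 ≤ entry t i)
             × (+ 3 * (sq (a t) + sq (b t) + sq (c t) + sq (d t)) ≡ sq (qsum t))

-- the generators S₁,…,S₄ (indexed by Fin 4: zero ↦ S₁, …)
S : Fin 4 → Quad → Quad
S zero (quad a b c d) = quad (b + c + d - a) b c d
S (suc zero) (quad a b c d) = quad a (a + c + d - b) c d
S (suc (suc zero)) (quad a b c d) = quad a b (a + b + d - c) d
S (suc (suc (suc zero))) (quad a b c d) = quad a b c (a + b + c - d)

applyWord : List (Fin 4) → Quad → Quad
applyWord [] t = t
applyWord (i ∷ w) t = applyWord w (S i t)

IsRoot : Quad → Set
IsRoot t = IsTriangle t × (∀ i → ¬ (qsum (S i t) < qsum t))

IsLargest : Quad → Fin 4 → Set
IsLargest t i = ∀ j → entry t j ≤ entry t i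

gcd4 : Quad → ℕ
gcd4 t = gcd (gcd (gcd ∣ a t ∣ ∣ b t ∣) ∣ c t ∣) ∣ d t ∣

IsPermOf : Quad → Quad → Set
IsPermOf t s = Σ (Permutation′ 4) λ π → ∀ j → entry t (π ⟨$⟩ʳ j) ≡ entry s j

-- Let e_i = 3 x_i - (a + b + c + d), so that S_i lowers the sum by exactly e_i.  If a is a
-- largest entry of a triangle quadruple (a, b, c, d), then up to a multiple of the triangle
-- form 3(a² + b² + c² + d²) - (a + b + c + d)²
--   a²(2a - b - c - d) = (a-b)(a-c)(a-d) + bcd + a(b(a-b) + c(a-c) + d(a-d)),
-- and every summand on the right is nonnegative, so e_1 ≥ 0.  If e_1 = 0 each of b, c, d is
-- 0 or a, so the quadruple is a permutation of (0, a, a, a), and it is a root because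
-- e_i ≤ e_1 = 0 for all i.  Otherwise reflecting the largest entry strictly lowers the
-- nonnegative sum, keeps the triangle condition (2a(b + c + d - a) is a sum of squares on the
-- cone) and keeps the gcd (each S_i is an involution of ℤ⁴), so the descent stops at a root
-- that is a permutation of (0, g, g, g).

{-# OPTIONS --safe #-}
module Submission where

open import Defs
open import Data.Integer
  using (ℤ; +_; 0ℤ; -[1+_]; _+_; _-_; _*_; _≤_; _<_; +≤+; +<+; ∣_∣; nonNegative; positive; >-nonZero)
open import Data.Integer.Properties
open import Data.Integer.Tactic.RingSolver using (solve-∀; solve)
open import Data.Integer.Divisibility.Signed using (∣ᵤ⇒∣; ∣⇒∣ᵤ; ∣m∣n⇒∣m+n; ∣m∣n⇒∣m-n)
  renaming (_∣_ to _∣ℤ_; ∣-refl to ∣ℤ-refl)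
open import Data.Nat as ℕ using (ℕ; zero; suc; z≤n; s≤s)
import Data.Nat.Properties as ℕₚ
open import Data.Nat.Divisibility using (_∣_; ∣-antisym; ∣-trans; _∣0)
open import Data.Nat.GCD using (gcd; gcd[m,n]∣m; gcd[m,n]∣n; gcd-greatest)
open import Data.Fin using (Fin)
open import Data.Fin.Patterns using (0F; 1F; 2F; 3F)
open import Data.Fin.Permutation using (_⟨$⟩ʳ_; _⟨$⟩ˡ_; flip; _∘ₚ_; inverseʳ; insert; id)
open import Data.List using (List; []; _∷_; allFin)
open import Data.List.Extrema ≤-totalOrder using (argmax; f[xs]≤f[argmax])
open import Data.List.Membership.Propositional.Properties using (∈-allFin)
open import Data.List.Relation.Unary.All using (lookup)
open import Data.Product using (Σ; _×_; _,_; proj₁; proj₂)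
open import Data.Sum using (_⊎_; inj₁; inj₂)
open import Data.Empty using (⊥; ⊥-elim)
open import Relation.Binary.PropositionalEquality
open ≡-Reasoning

0≤i⇒i≡0⊎0<i : ∀ {i} → 0ℤ ≤ i → i ≡ 0ℤ ⊎ 0ℤ < i
0≤i⇒i≡0⊎0<i {+ zero}  _ = inj₁ refl
0≤i⇒i≡0⊎0<i {+ suc n} _ = inj₂ (+<+ (s≤s z≤n))

0≤i*j : ∀ {i j} → 0ℤ ≤ i → 0ℤ ≤ j → 0ℤ ≤ i * j
0≤i*j {i} 0≤i 0≤j = subst (_≤ i * _) (*-zeroʳ i) (*-monoˡ-≤-nonNeg i {{nonNegative 0≤i}} 0≤j)

0≤i*i : ∀ i → 0ℤ ≤ i * i
0≤i*i (+ n)     = 0≤i*j {+ n} (+≤+ z≤n) (+≤+ z≤n)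
0≤i*i -[1+ n ] = +≤+ z≤n

0≤k*i⇒0≤i : ∀ {k i} → 0ℤ < k → 0ℤ ≤ k * i → 0ℤ ≤ i
0≤k*i⇒0≤i {k} {i} 0<k 0≤ki =
  *-cancelˡ-≤-pos 0ℤ i k {{positive 0<k}} (subst (_≤ k * i) (sym (*-zeroʳ k)) 0≤ki)

nonNeg-i+j≡0⇒i≡0∧j≡0 : ∀ {i j} → 0ℤ ≤ i → 0ℤ ≤ j → i + j ≡ 0ℤ → i ≡ 0ℤ × j ≡ 0ℤ
nonNeg-i+j≡0⇒i≡0∧j≡0 {+ zero}  {+ zero}  _ _ _  = refl , refl
nonNeg-i+j≡0⇒i≡0∧j≡0 {+ zero}  {+ suc _} _ _ ()
nonNeg-i+j≡0⇒i≡0∧j≡0 {+ suc _} {+ _}     _ _ ()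

nonNeg-i+j+k≡0⇒i≡0∧j≡0∧k≡0 : ∀ {i j k} → 0ℤ ≤ i → 0ℤ ≤ j → 0ℤ ≤ k → i + j + k ≡ 0ℤ →
  i ≡ 0ℤ × j ≡ 0ℤ × k ≡ 0ℤ
nonNeg-i+j+k≡0⇒i≡0∧j≡0∧k≡0 0≤i 0≤j 0≤k eq
  with nonNeg-i+j≡0⇒i≡0∧j≡0 (+-mono-≤ 0≤i 0≤j) 0≤k eq
... | i+j≡0 , k≡0 with nonNeg-i+j≡0⇒i≡0∧j≡0 0≤i 0≤j i+j≡0
...   | i≡0 , j≡0 = i≡0 , j≡0 , k≡0

∣∣-mono-< : ∀ {i j} → 0ℤ ≤ i → i < j → ∣ i ∣ ℕ.< ∣ j ∣
∣∣-mono-< {+ _} _ (+<+ m<n) = m<n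

NonNegativeEntries : Quad → Set
NonNegativeEntries t = ∀ j → 0ℤ ≤ entry t j

entrySum : (ℤ → ℤ) → Quad → ℤ
entrySum f t = f (a t) + f (b t) + f (c t) + f (d t)

form : Quad → ℤ
form t = + 3 * entrySum sq t - sq (qsum t)

excess : Quad → Fin 4 → ℤ
excess t i = + 3 * entry t i - qsum t

IsTriangle⇒form≡0 : ∀ {t} → IsTriangle t → form t ≡ 0ℤ
IsTriangle⇒form≡0 (_ , eq) = i≡j⇒i-j≡0 eq

form≡0⇒IsTriangle : ∀ {t} → NonNegativeEntries t → form t ≡ 0ℤ → IsTriangle t
form≡0⇒IsTriangle nonneg form≡0 = nonneg , i-j≡0⇒i≡j _ _ form≡0

IsPermOf-refl : ∀ {t} → IsPermOf t t
IsPermOf-refl = id , λ _ → refl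

IsPermOf-sym : ∀ {t s} → IsPermOf t s → IsPermOf s t
IsPermOf-sym {t} (π , eq) = flip π , λ j → trans (sym (eq (π ⟨$⟩ˡ j))) (cong (entry t) (inverseʳ π))

IsPermOf-trans : ∀ {t u s} → IsPermOf t u → IsPermOf u s → IsPermOf t s
IsPermOf-trans (π , p) (ρ , q) = ρ ∘ₚ π , λ j → trans (p (ρ ⟨$⟩ʳ j)) (q j)

IsPermOf-all : ∀ {t s} (P : ℤ → Set) → IsPermOf t s → (∀ j → P (entry t j)) → ∀ j → P (entry s j)
IsPermOf-all P (π , eq) h j = subst P (eq j) (h (π ⟨$⟩ʳ j))

-- Entry i moves to the front and the others keep their order; this is what makes S-pivot hold
-- by computation, so everything proved for S 0F transfers to S i.
pivot : Fin 4 → Quad → Quad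
pivot i t = quad (e 0F) (e 1F) (e 2F) (e 3F)
  where
  e : Fin 4 → ℤ
  e j = entry t (insert 0F i id ⟨$⟩ʳ j)

IsPermOf-pivot : ∀ i t → IsPermOf t (pivot i t)
IsPermOf-pivot i t = insert 0F i id , λ { 0F → refl ; 1F → refl ; 2F → refl ; 3F → refl }

S-pivot : ∀ i t → pivot i (S i t) ≡ S 0F (pivot i t)
S-pivot 0F _ = refl
S-pivot 1F _ = refl
S-pivot 2F _ = refl
S-pivot 3F _ = refl

entrySum-pivot : ∀ f i t → entrySum f (pivot i t) ≡ entrySum f t
entrySum-pivot f 0F t = refl
entrySum-pivot f 1F t = swap₀₁ (f (a t)) (f (b t)) (f (c t)) (f (d t))
  where
  swap₀₁ : ∀ w x y z → x + w + y + z ≡ w + x + y + z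
  swap₀₁ = solve-∀
entrySum-pivot f 2F t = rotate₀₂ (f (a t)) (f (b t)) (f (c t)) (f (d t))
  where
  rotate₀₂ : ∀ w x y z → y + w + x + z ≡ w + x + y + z
  rotate₀₂ = solve-∀
entrySum-pivot f 3F t = rotate₀₃ (f (a t)) (f (b t)) (f (c t)) (f (d t))
  where
  rotate₀₃ : ∀ w x y z → z + w + x + y ≡ w + x + y + z
  rotate₀₃ = solve-∀

qsum-pivot : ∀ i t → qsum (pivot i t) ≡ qsum t
qsum-pivot = entrySum-pivot (λ x → x)

form-pivot : ∀ i t → form (pivot i t) ≡ form t
form-pivot i t = cong₂ (λ s q → + 3 * s - sq q) (entrySum-pivot sq i t) (qsum-pivot i t)

excess-pivot : ∀ i t → excess (pivot i t) 0F ≡ excess t i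
excess-pivot i t = cong (_-_ (+ 3 * entry t i)) (qsum-pivot i t)

IsLargest-pivot : ∀ i {t} → IsLargest t i → IsLargest (pivot i t) 0F
IsLargest-pivot i {t} = IsPermOf-all (_≤ entry t i) (IsPermOf-pivot i t)

IsTriangle-perm : ∀ {t s} → IsPermOf t s → form s ≡ form t → IsTriangle t → IsTriangle s
IsTriangle-perm p form-eq tri@(nonneg , _) =
  form≡0⇒IsTriangle (IsPermOf-all (0ℤ ≤_) p nonneg) (trans form-eq (IsTriangle⇒form≡0 tri))

IsTriangle-pivot : ∀ i {t} → IsTriangle t → IsTriangle (pivot i t)
IsTriangle-pivot i {t} = IsTriangle-perm (IsPermOf-pivot i t) (form-pivot i t)

form-S₀ : ∀ t → form (S 0F t) ≡ form t
form-S₀ (quad a b c d) = identity a b c d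
  where
  identity : ∀ a b c d →
    + 3 * ((b + c + d - a) * (b + c + d - a) + b * b + c * c + d * d)
      - (b + c + d - a + b + c + d) * (b + c + d - a + b + c + d)
    ≡ + 3 * (a * a + b * b + c * c + d * d) - (a + b + c + d) * (a + b + c + d)
  identity = solve-∀

qsum-S₀ : ∀ t → qsum (S 0F t) ≡ qsum t - excess t 0F
qsum-S₀ (quad a b c d) = identity a b c d
  where
  identity : ∀ a b c d → b + c + d - a + b + c + d ≡ a + b + c + d - (+ 3 * a - (a + b + c + d))
  identity = solve-∀

S₀-nonneg : ∀ {t} → NonNegativeEntries t → form t ≡ 0ℤ → 0ℤ ≤ a (S 0F t)
S₀-nonneg {quad a b c d} nonneg form≡0 with 0≤i⇒i≡0⊎0<i (nonneg 0F)
... | inj₁ refl = subst (0ℤ ≤_) (sym (+-identityʳ (b + c + d)))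
                    (+-mono-≤ (+-mono-≤ (nonneg 1F) (nonneg 2F)) (nonneg 3F))
... | inj₂ 0<a =
  0≤k*i⇒0≤i 0<a (0≤k*i⇒0≤i {+ 2} (+<+ (s≤s z≤n)) (subst (0ℤ ≤_) (sym doubled) 0≤squares))
  where
  squares : ℤ
  squares = (b - c) * (b - c) + (b - d) * (b - d) + (c - d) * (c - d)
  0≤squares : 0ℤ ≤ squares
  0≤squares = +-mono-≤ (+-mono-≤ (0≤i*i (b - c)) (0≤i*i (b - d))) (0≤i*i (c - d))
  identity : ∀ a b c d → + 2 * (a * (b + c + d - a)) ≡
    (b - c) * (b - c) + (b - d) * (b - d) + (c - d) * (c - d)
      - (+ 3 * (a * a + b * b + c * c + d * d) - (a + b + c + d) * (a + b + c + d))
  identity = solve-∀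
  doubled : + 2 * (a * (b + c + d - a)) ≡ squares
  doubled = begin
    + 2 * (a * (b + c + d - a))         ≡⟨ identity a b c d ⟩
    squares - form (quad a b c d)       ≡⟨ cong (squares -_) form≡0 ⟩
    squares - 0ℤ                        ≡⟨ +-identityʳ squares ⟩
    squares                             ∎

IsTriangle-S₀ : ∀ {t} → IsTriangle t → IsTriangle (S 0F t)
IsTriangle-S₀ {t} tri@(nonneg , _) = form≡0⇒IsTriangle nonneg′ (trans (form-S₀ t) form≡0)
  where
  form≡0 : form t ≡ 0ℤ
  form≡0 = IsTriangle⇒form≡0 tri
  nonneg′ : NonNegativeEntries (S 0F t)
  nonneg′ 0F = S₀-nonneg nonneg form≡0
  nonneg′ 1F = nonneg 1F
  nonneg′ 2F = nonneg 2F
  nonneg′ 3F = nonneg 3F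

qsum-S : ∀ i t → qsum (S i t) ≡ qsum t - excess t i
qsum-S i t = begin
  qsum (S i t)                              ≡⟨ qsum-pivot i (S i t) ⟨
  qsum (pivot i (S i t))                    ≡⟨ cong qsum (S-pivot i t) ⟩
  qsum (S 0F (pivot i t))                   ≡⟨ qsum-S₀ (pivot i t) ⟩
  qsum (pivot i t) - excess (pivot i t) 0F  ≡⟨ cong₂ _-_ (qsum-pivot i t) (excess-pivot i t) ⟩
  qsum t - excess t i                       ∎

IsTriangle-S : ∀ i {t} → IsTriangle t → IsTriangle (S i t)
IsTriangle-S i {t} tri =
  IsTriangle-perm (IsPermOf-sym (IsPermOf-pivot i (S i t))) (sym (form-pivot i (S i t)))
    (subst IsTriangle (sym (S-pivot i t)) (IsTriangle-S₀ (IsTriangle-pivot i tri)))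

ZeroOr : ℤ → ℤ → Set
ZeroOr a x = x ≡ 0ℤ ⊎ x ≡ a

x[a-x]≡0⇒ZeroOr : ∀ {a x} → x * (a - x) ≡ 0ℤ → ZeroOr a x
x[a-x]≡0⇒ZeroOr {a} {x} eq with i*j≡0⇒i≡0∨j≡0 x eq
... | inj₁ x≡0   = inj₁ x≡0
... | inj₂ a-x≡0 = inj₂ (sym (i-j≡0⇒i≡j a x a-x≡0))

nonzero-multiple : ∀ {a l r} → 0ℤ < a → l ≡ r → ∀ k → k ≢ 0ℤ → l - r ≡ k * a → ⊥
nonzero-multiple 0<a l≡r k k≢0 l-r≡ka with i*j≡0⇒i≡0∨j≡0 k (trans (sym l-r≡ka) (i≡j⇒i-j≡0 l≡r))
... | inj₁ k≡0 = k≢0 k≡0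
... | inj₂ a≡0 = <-irrefl (sym a≡0) 0<a

IsPermOf-0aaa : ∀ {a b c d} → 0ℤ < a → ZeroOr a b → ZeroOr a c → ZeroOr a d →
  b + c + d ≡ a + a → IsPermOf (quad a b c d) (quad 0ℤ a a a)
IsPermOf-0aaa _ (inj₁ refl) (inj₂ refl) (inj₂ refl) _ = IsPermOf-pivot 1F _
IsPermOf-0aaa _ (inj₂ refl) (inj₁ refl) (inj₂ refl) _ = IsPermOf-pivot 2F _
IsPermOf-0aaa _ (inj₂ refl) (inj₂ refl) (inj₁ refl) _ = IsPermOf-pivot 3F _
IsPermOf-0aaa {a} 0<a (inj₂ refl) (inj₂ refl) (inj₂ refl) eq =
  ⊥-elim (nonzero-multiple 0<a eq (+ 1) (λ ()) (solve (a ∷ [])))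
IsPermOf-0aaa {a} 0<a (inj₂ refl) (inj₁ refl) (inj₁ refl) eq =
  ⊥-elim (nonzero-multiple 0<a eq -[1+ 0 ] (λ ()) (solve (a ∷ [])))
IsPermOf-0aaa {a} 0<a (inj₁ refl) (inj₂ refl) (inj₁ refl) eq =
  ⊥-elim (nonzero-multiple 0<a eq -[1+ 0 ] (λ ()) (solve (a ∷ [])))
IsPermOf-0aaa {a} 0<a (inj₁ refl) (inj₁ refl) (inj₂ refl) eq =
  ⊥-elim (nonzero-multiple 0<a eq -[1+ 0 ] (λ ()) (solve (a ∷ [])))
IsPermOf-0aaa {a} 0<a (inj₁ refl) (inj₁ refl) (inj₁ refl) eq =
  ⊥-elim (nonzero-multiple 0<a eq -[1+ 1 ] (λ ()) (solve (a ∷ [])))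

IsLargest-zero : ∀ {t i} → NonNegativeEntries t → IsLargest t i → entry t i ≡ 0ℤ → ∀ j → entry t j ≡ 0ℤ
IsLargest-zero {t} nonneg largest eq j = ≤-antisym (subst (entry t j ≤_) eq (largest j)) (nonneg j)

cubic-identity : ∀ a b c d →
  + 2 * (a * (a * (+ 3 * a - (a + b + c + d)))) ≡
  + 2 * ((a - b) * (a - c) * (a - d) + b * c * d + a * (b * (a - b) + c * (a - c) + d * (a - d)))
    + a * (+ 3 * (a * a + b * b + c * c + d * d) - (a + b + c + d) * (a + b + c + d))
cubic-identity = solve-∀

module _ {a b c d : ℤ} (tri : IsTriangle (quad a b c d)) (largest : IsLargest (quad a b c d) 0F) where

  private
    t : Quad
    t = quad a b c d

    vanish : a ≡ 0ℤ → ∀ j → entry t j ≡ 0ℤ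
    vanish = IsLargest-zero {i = 0F} (proj₁ tri) largest

    0≤x[a-x] : ∀ j → 0ℤ ≤ entry t j * (a - entry t j)
    0≤x[a-x] j = 0≤i*j (proj₁ tri j) (i≤j⇒0≤j-i (largest j))

    spread : ℤ
    spread = b * (a - b) + c * (a - c) + d * (a - d)

    cubic : ℤ
    cubic = (a - b) * (a - c) * (a - d) + b * c * d + a * spread

    0≤spread : 0ℤ ≤ spread
    0≤spread = +-mono-≤ (+-mono-≤ (0≤x[a-x] 1F) (0≤x[a-x] 2F)) (0≤x[a-x] 3F)

    0≤products : 0ℤ ≤ (a - b) * (a - c) * (a - d) + b * c * d
    0≤products = +-mono-≤ (0≤i*j (0≤i*j (0≤a- 1F) (0≤a- 2F)) (0≤a- 3F))
                          (0≤i*j (0≤i*j (proj₁ tri 1F) (proj₁ tri 2F)) (proj₁ tri 3F))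
      where
      0≤a- : ∀ j → 0ℤ ≤ a - entry t j
      0≤a- j = i≤j⇒0≤j-i (largest j)

    0≤a*spread : 0ℤ ≤ a * spread
    0≤a*spread = 0≤i*j (proj₁ tri 0F) 0≤spread

    a[a·excess]≡cubic : a * (a * excess t 0F) ≡ cubic
    a[a·excess]≡cubic = *-cancelˡ-≡ (+ 2) _ _ (begin
      + 2 * (a * (a * excess t 0F))  ≡⟨ cubic-identity a b c d ⟩
      + 2 * cubic + a * form t       ≡⟨ cong (λ f → + 2 * cubic + a * f) (IsTriangle⇒form≡0 tri) ⟩
      + 2 * cubic + a * 0ℤ           ≡⟨ cong (_+_ (+ 2 * cubic)) (*-zeroʳ a) ⟩
      + 2 * cubic + 0ℤ               ≡⟨ +-identityʳ (+ 2 * cubic) ⟩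
      + 2 * cubic                    ∎)

  excess₀-nonneg : 0ℤ ≤ excess t 0F
  excess₀-nonneg with 0≤i⇒i≡0⊎0<i (proj₁ tri 0F)
  ... | inj₂ 0<a = 0≤k*i⇒0≤i 0<a (0≤k*i⇒0≤i 0<a
                     (subst (0ℤ ≤_) (sym a[a·excess]≡cubic) (+-mono-≤ 0≤products 0≤a*spread)))
  ... | inj₁ refl with vanish refl 1F | vanish refl 2F | vanish refl 3F
  ...   | refl | refl | refl = ≤-refl

  private
    excess≡0⇒spread≡0 : 0ℤ < a → excess t 0F ≡ 0ℤ → spread ≡ 0ℤ
    excess≡0⇒spread≡0 0<a excess≡0 = *-cancelˡ-≡ a spread 0ℤ {{>-nonZero 0<a}} (begin
      a * spread  ≡⟨ proj₂ (nonNeg-i+j≡0⇒i≡0∧j≡0 0≤products 0≤a*spread cubic≡0) ⟩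
      0ℤ          ≡⟨ *-zeroʳ a ⟨
      a * 0ℤ      ∎)
      where
      cubic≡0 : cubic ≡ 0ℤ
      cubic≡0 = begin
        cubic                 ≡⟨ a[a·excess]≡cubic ⟨
        a * (a * excess t 0F) ≡⟨ cong (λ e → a * (a * e)) excess≡0 ⟩
        a * (a * 0ℤ)          ≡⟨ cong (a *_) (*-zeroʳ a) ⟩
        a * 0ℤ                ≡⟨ *-zeroʳ a ⟩
        0ℤ                    ∎

    excess≡0⇒b+c+d≡a+a : excess t 0F ≡ 0ℤ → b + c + d ≡ a + a
    excess≡0⇒b+c+d≡a+a excess≡0 = sym (i-j≡0⇒i≡j _ _ (trans (sym (identity a b c d)) excess≡0))
      where
      identity : ∀ a b c d → + 3 * a - (a + b + c + d) ≡ a + a - (b + c + d)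
      identity = solve-∀

    spread≡0⇒ZeroOr : spread ≡ 0ℤ → ZeroOr a b × ZeroOr a c × ZeroOr a d
    spread≡0⇒ZeroOr spread≡0
      with nonNeg-i+j+k≡0⇒i≡0∧j≡0∧k≡0 (0≤x[a-x] 1F) (0≤x[a-x] 2F) (0≤x[a-x] 3F) spread≡0
    ... | b[a-b]≡0 , c[a-c]≡0 , d[a-d]≡0 =
      x[a-x]≡0⇒ZeroOr b[a-b]≡0 , x[a-x]≡0⇒ZeroOr c[a-c]≡0 , x[a-x]≡0⇒ZeroOr d[a-d]≡0

  excess₀-zero : excess t 0F ≡ 0ℤ → IsPermOf t (quad 0ℤ a a a)
  excess₀-zero excess≡0 with 0≤i⇒i≡0⊎0<i (proj₁ tri 0F)
  ... | inj₂ 0<a = let (b∈0a , c∈0a , d∈0a) = spread≡0⇒ZeroOr (excess≡0⇒spread≡0 0<a excess≡0) in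
    IsPermOf-0aaa 0<a b∈0a c∈0a d∈0a (excess≡0⇒b+c+d≡a+a excess≡0)
  ... | inj₁ refl with vanish refl 1F | vanish refl 2F | vanish refl 3F
  ...   | refl | refl | refl = IsPermOf-refl

excess-nonneg : ∀ {t} i → IsTriangle t → IsLargest t i → 0ℤ ≤ excess t i
excess-nonneg {t} i tri largest =
  subst (0ℤ ≤_) (excess-pivot i t) (excess₀-nonneg (IsTriangle-pivot i tri) (IsLargest-pivot i largest))

excess≡0⇒IsPermOf : ∀ {t} i → IsTriangle t → IsLargest t i → excess t i ≡ 0ℤ →
  IsPermOf t (quad 0ℤ (entry t i) (entry t i) (entry t i))
excess≡0⇒IsPermOf {t} i tri largest excess≡0 = IsPermOf-trans (IsPermOf-pivot i t)
  (excess₀-zero (IsTriangle-pivot i tri) (IsLargest-pivot i largest) (trans (excess-pivot i t) excess≡0))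

excess-mono : ∀ {t} i j → entry t i ≤ entry t j → excess t i ≤ excess t j
excess-mono i j le = +-monoˡ-≤ _ (*-monoˡ-≤-nonNeg (+ 3) le)

S-largest-nonincreasing : ∀ {t} i → IsTriangle t → IsLargest t i → qsum (S i t) ≤ qsum t
S-largest-nonincreasing {t} i tri largest = subst (_≤ qsum t) (sym (qsum-S i t))
  (i-j≤i (qsum t) (excess t i) {{nonNegative (excess-nonneg i tri largest)}})

0<excess⇒qsum-S<qsum : ∀ {t} i → 0ℤ < excess t i → qsum (S i t) < qsum t
0<excess⇒qsum-S<qsum {t} i 0<e = subst₂ _<_ (sym (qsum-S i t)) (+-identityʳ (qsum t))
  (+-monoʳ-< (qsum t) (neg-mono-< 0<e))

excess≡0⇒IsRoot : ∀ {t} m → IsTriangle t → IsLargest t m → excess t m ≡ 0ℤ → IsRoot t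
excess≡0⇒IsRoot {t} m tri largest excess≡0 = tri , λ i → ≤⇒≯ (sum≤ i)
  where
  sum≤ : ∀ i → qsum t ≤ qsum (S i t)
  sum≤ i = subst₂ _≤_ (+-identityʳ (qsum t)) (sym (qsum-S i t))
    (+-monoʳ-≤ (qsum t) (neg-mono-≤ (subst (excess t i ≤_) excess≡0 (excess-mono i m (largest i)))))

CommonDivisor : ℕ → Quad → Set
CommonDivisor k t = ∀ j → + k ∣ℤ entry t j

gcd4-commonDivisor : ∀ t → CommonDivisor (gcd4 t) t
gcd4-commonDivisor t j = ∣ᵤ⇒∣ (divides j)
  where
  g₂ g₃ : ℕ
  g₂ = gcd ∣ a t ∣ ∣ b t ∣
  g₃ = gcd g₂ ∣ c t ∣
  divides : ∀ j → gcd4 t ∣ ∣ entry t j ∣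
  divides 0F = ∣-trans (gcd[m,n]∣m g₃ _) (∣-trans (gcd[m,n]∣m g₂ _) (gcd[m,n]∣m ∣ a t ∣ _))
  divides 1F = ∣-trans (gcd[m,n]∣m g₃ _) (∣-trans (gcd[m,n]∣m g₂ _) (gcd[m,n]∣n ∣ a t ∣ _))
  divides 2F = ∣-trans (gcd[m,n]∣m g₃ _) (gcd[m,n]∣n g₂ _)
  divides 3F = gcd[m,n]∣n g₃ _

gcd4-greatest : ∀ {k} t → CommonDivisor k t → k ∣ gcd4 t
gcd4-greatest t h =
  gcd-greatest (gcd-greatest (gcd-greatest (∣⇒∣ᵤ (h 0F)) (∣⇒∣ᵤ (h 1F))) (∣⇒∣ᵤ (h 2F))) (∣⇒∣ᵤ (h 3F))

gcd4-perm : ∀ {t s} → IsPermOf t s → gcd4 t ≡ gcd4 s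
gcd4-perm {t} {s} p = ∣-antisym
  (gcd4-greatest s (IsPermOf-all (+ gcd4 t ∣ℤ_) p (gcd4-commonDivisor t)))
  (gcd4-greatest t (IsPermOf-all (+ gcd4 s ∣ℤ_) (IsPermOf-sym p) (gcd4-commonDivisor s)))

gcd4-0nnn : ∀ n → gcd4 (quad 0ℤ (+ n) (+ n) (+ n)) ≡ n
gcd4-0nnn n = ∣-antisym (∣⇒∣ᵤ (gcd4-commonDivisor (quad 0ℤ (+ n) (+ n) (+ n)) 1F))
  (gcd4-greatest (quad 0ℤ (+ n) (+ n) (+ n))
    λ { 0F → ∣ᵤ⇒∣ (n ∣0) ; 1F → ∣ℤ-refl ; 2F → ∣ℤ-refl ; 3F → ∣ℤ-refl })

CommonDivisor-S₀ : ∀ {k} t → CommonDivisor k t → CommonDivisor k (S 0F t)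
CommonDivisor-S₀ _ h 0F = ∣m∣n⇒∣m-n (∣m∣n⇒∣m+n (∣m∣n⇒∣m+n (h 1F) (h 2F)) (h 3F)) (h 0F)
CommonDivisor-S₀ _ h 1F = h 1F
CommonDivisor-S₀ _ h 2F = h 2F
CommonDivisor-S₀ _ h 3F = h 3F

CommonDivisor-S : ∀ {k} i t → CommonDivisor k t → CommonDivisor k (S i t)
CommonDivisor-S {k} i t h = IsPermOf-all (+ k ∣ℤ_) (IsPermOf-sym (IsPermOf-pivot i (S i t)))
  (subst (CommonDivisor _) (sym (S-pivot i t))
    (CommonDivisor-S₀ (pivot i t) (IsPermOf-all (+ k ∣ℤ_) (IsPermOf-pivot i t) h)))

u-[u-x]≡x : ∀ u x → u - (u - x) ≡ x
u-[u-x]≡x = solve-∀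

S-involutive : ∀ i t → S i (S i t) ≡ t
S-involutive 0F (quad a b c d) = cong (λ x → quad x b c d) (u-[u-x]≡x (b + c + d) a)
S-involutive 1F (quad a b c d) = cong (λ x → quad a x c d) (u-[u-x]≡x (a + c + d) b)
S-involutive 2F (quad a b c d) = cong (λ x → quad a b x d) (u-[u-x]≡x (a + b + d) c)
S-involutive 3F (quad a b c d) = cong (λ x → quad a b c x) (u-[u-x]≡x (a + b + c) d)

gcd4-S : ∀ i t → gcd4 (S i t) ≡ gcd4 t
gcd4-S i t = ∣-antisym
  (gcd4-greatest t (subst (CommonDivisor _) (S-involutive i t)
    (CommonDivisor-S i (S i t) (gcd4-commonDivisor (S i t)))))
  (gcd4-greatest (S i t) (CommonDivisor-S i t (gcd4-commonDivisor t)))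

IsPermOf-0ggg : ∀ {t x} → 0ℤ ≤ x → IsPermOf t (quad 0ℤ x x x) →
  IsPermOf t (quad 0ℤ (+ gcd4 t) (+ gcd4 t) (+ gcd4 t))
IsPermOf-0ggg {t} {+ n} _ p =
  subst (λ g → IsPermOf t (quad 0ℤ (+ g) (+ g) (+ g))) (sym (trans (gcd4-perm p) (gcd4-0nnn n))) p

ReducesToRoot : Quad → Set
ReducesToRoot t = Σ (List (Fin 4)) λ w →
  IsRoot (applyWord w t) × IsPermOf (applyWord w t) (quad (+ 0) (+ gcd4 t) (+ gcd4 t) (+ gcd4 t))

ReducesToRoot-S : ∀ i t → ReducesToRoot (S i t) → ReducesToRoot t
ReducesToRoot-S i t (w , root , perm) =
  i ∷ w , root ,
  subst (λ g → IsPermOf (applyWord w (S i t)) (quad (+ 0) (+ g) (+ g) (+ g))) (gcd4-S i t) perm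

largest-exists : ∀ t → Σ (Fin 4) (IsLargest t)
largest-exists t =
  argmax (entry t) 0F (allFin 4) , λ j → lookup (f[xs]≤f[argmax] {f = entry t} 0F (allFin 4)) (∈-allFin j)

qsum-nonneg : ∀ {t} → NonNegativeEntries t → 0ℤ ≤ qsum t
qsum-nonneg nonneg = +-mono-≤ (+-mono-≤ (+-mono-≤ (nonneg 0F) (nonneg 1F)) (nonneg 2F)) (nonneg 3F)

reduceToRoot : ∀ n t → IsTriangle t → ∣ qsum t ∣ ℕ.< n → ReducesToRoot t
reduceToRoot (suc n) t tri bound = reduceToRoot-at (largest-exists t)
  where
  reduceToRoot-at : Σ (Fin 4) (IsLargest t) → ReducesToRoot t
  reduceToRoot-at (m , largest) with 0≤i⇒i≡0⊎0<i (excess-nonneg m tri largest)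
  ... | inj₁ excess≡0 = [] , excess≡0⇒IsRoot m tri largest excess≡0
                          , IsPermOf-0ggg (proj₁ tri m) (excess≡0⇒IsPermOf m tri largest excess≡0)
  ... | inj₂ 0<excess = ReducesToRoot-S m t (reduceToRoot n (S m t) tri′ bound′)
    where
    tri′ : IsTriangle (S m t)
    tri′ = IsTriangle-S m tri
    bound′ : ∣ qsum (S m t) ∣ ℕ.< n
    bound′ = ℕₚ.<-≤-trans (∣∣-mono-< (qsum-nonneg (proj₁ tri′)) (0<excess⇒qsum-S<qsum m 0<excess))
                          (ℕ.s≤s⁻¹ bound)

lemma1 : (t : Quad) → IsTriangle t →
    ((i : Fin 4) → IsLargest t i → qsum (S i t) ≤ qsum t)
    × Σ (List (Fin 4)) (λ w →
        IsRoot (applyWord w t)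
        × IsPermOf (applyWord w t) (quad (+ 0) (+ gcd4 t) (+ gcd4 t) (+ gcd4 t)))
lemma1 t tri = (λ i → S-largest-nonincreasing i tri) 
  , reduceToRoot (suc ∣ qsum t ∣) t tri (ℕₚ.n<1+n _)
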